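{- All of the equations $(\Delta_{\alpha}, \nabla_{\!\beta})^{*}$ are canonical: whenever a modal algebra (a Heyting, co-Heyting or bi-Heyting algebra as required by the connectives of the equation) satisfies $(\Delta_{\alpha}, \nabla_{\!\beta})^{*}$, its canonical frame satisfies the corresponding frame condition $(\Delta_{\alpha}, \nabla_{\!\beta})^{*}$ (equivalently, its canonical extension satisfies the equation).
   Context: Forward modal operators on a bounded distributive lattice: $\Box_+$ preserves finite meets; $\Diamond_+$ preserves finite joins; $\Box_-(a\vee b)=\Box_-a\wedge\Box_-b$, $\Box_-\bot=\top$; $\Diamond_-(a\wedge b)=\Diamond_-a\vee\Diamond_-b$, $\Diamond_-\top=\bot$. $\rightarrow$ is Heyting implication, $-$ co-implication. The canonical frame of such an algebra $\mathbf{A}$ is the set of prime filters ordered by inclusion with $\mathcal{U}R^\Box_+\mathcal{V}$ iff ($\Box_+a\in\mathcal{U}\Rightarrow a\in\mathcal{V}$), $\mathcal{U}R^\Box_-\mathcal{V}$ iff ($\Box_-a\in\mathcal{U}\Rightarrow a\notin\mathcal{V}$), $\mathcal{U}R^\Diamond_+\mathcal{V}$ iff ($a\in\mathcal{V}\Rightarrow\Diamond_+a\in\mathcal{U}$), $\mathcal{U}R^\Diamond_-\mathcal{V}$ iff ($a\notin\mathcal{V}\Rightarrow\Diamond_-a\in\mathcal{U}$); the canonical extension is the complex algebra of upsets of this frame. Equations / frame conditions (backward modalities $\overleftarrow{\Box}_\alpha,\overleftarrow{\Diamond}_\alpha$ used only as labels): $(\Diamond_+,\Box_+)^*$: $\Box_+a\wedge\Diamond_+b\le\Diamond_+(a\wedge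 b)$ / $R^\Diamond_+\subseteq(R^\Diamond_+\cap R^\Box_+)\circ{\ge}$; $(\Diamond_-,\Box_-)^*$: $\Box_-a\wedge\Diamond_-b\le\Diamond_-(a\vee b)$ / $R^\Diamond_-\subseteq(R^\Diamond_-\cap R^\Box_-)\circ{\le}$; $(\Box_+,\Diamond_+)^*$: $\Box_+(a\vee b)\le\Box_+a\vee\Diamond_+b$ / $R^\Box_+\subseteq(R^\Box_+\cap R^\Diamond_+)\circ{\le}$; $(\Box_-,\Diamond_-)^*$: $\Box_-(a\wedge b)\le\Box_-a\vee\Diamond_-b$ / $R^\Box_-\subseteq(R^\Box_-\cap R^\Diamond_-)\circ{\ge}$; $(\Diamond_+,\Box_-)^*$: $\Box_-a\wedge\Diamond_+a\le\bot$ / $R^\Diamond_+\subseteq R^\Box_-$; $(\Diamond_-,\Box_+)^*$: $\Box_+a\wedge\Diamond_-a\le\bot$ / $R^\Diamond_-\subseteq R^\Box_+$; $(\Box_+,\Diamond_-)^*$: $\top\le\Box_+a\vee\Diamond_-a$ / $R^\Box_+\subseteq R^\Diamond_-$; $(\Box_-,\Diamond_+)^*$: $\top\le\Box_-a\vee\Diamond_+a$ / $R^\Box_-\subseteq R^\Diamond_+$; $(\overleftarrow{\Diamond}_+,\overleftarrow{\Box}_+)^*$: $\Diamond_+a\rightarrow\Box_+b\le\Box_+(a\rightarrow b)$ / $R^\Box_+\subseteq{\le}\circ(R^\Box_+\cap R^\Diamond_+)$; $(\overleftarrow{\Diamond}_-,\overleftarrow{\Box}_-)^*$: $\Diamond_-(a\rightarrow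 b)\le\Diamond_-b-\Box_-a$ / $R^\Diamond_-\subseteq{\ge}\circ(R^\Diamond_-\cap R^\Box_-)$; $(\overleftarrow{\Box}_+,\overleftarrow{\Diamond}_+)^*$: $\Diamond_+(b-a)\le\Diamond_+b-\Box_+a$ / $R^\Diamond_+\subseteq{\ge}\circ(R^\Diamond_+\cap R^\Box_+)$; $(\overleftarrow{\Box}_-,\overleftarrow{\Diamond}_-)^*$: $\Diamond_-a\rightarrow\Box_-b\le\Box_-(b-a)$ / $R^\Box_-\subseteq{\le}\circ(R^\Box_-\cap R^\Diamond_-)$; $(\overleftarrow{\Diamond}_+,\overleftarrow{\Box}_-)^*$: $\Box_-a\le\Box_+(a\rightarrow\bot)$ / $R^\Box_+\subseteq R^\Box_-$; $(\overleftarrow{\Diamond}_-,\overleftarrow{\Box}_+)^*$: $\Diamond_-(a\rightarrow\bot)\le\Diamond_+a$ / $R^\Diamond_-\subseteq R^\Diamond_+$; $(\overleftarrow{\Box}_+,\overleftarrow{\Diamond}_-)^*$: $\Diamond_+(\top-a)\le\Diamond_-a$ / $R^\Diamond_+\subseteq R^\Diamond_-$; $(\overleftarrow{\Box}_-,\overleftarrow{\Diamond}_+)^*$: $\Box_+a\le\Box_-(\top-a)$ / $R^\Box_-\subseteq R^\Box_+$. -}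

module Defs where

open import Level using (Level; _⊔_; suc)
open import Data.Product using (Σ; ∃; _×_; _,_)
open import Data.Sum using (_⊎_)
open import Data.Empty using (⊥)
open import Relation.Nullary using (¬_)
open import Relation.Unary using (Pred; _∈_; _∉_; _⊆_)
open import Relation.Binary using (Rel; Setoid)
open import Relation.Binary.Lattice.Structures using (IsBoundedLattice)
open import Relation.Binary.Lattice.Definitions using (Exponential)
open import Algebra.Core using (Op₁; Op₂)

record BDLattice (c ℓ₁ ℓ₂ : Level) : Set (suc (c ⊔ ℓ₁ ⊔ ℓ₂)) where
  infixr 6 _∨_
  infixr 7 _∧_
  infix  4 _≈_ _≤_
  field
    Carrier          : Set c
    _≈_              : Rel Carrier ℓ₁
    _≤_              : Rel Carrier ℓ₂
    _∨_              : Op₂ Carrier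
    _∧_              : Op₂ Carrier
    ⊤                : Carrier
    ⊥ₗ               : Carrier
    isBoundedLattice : IsBoundedLattice _≈_ _≤_ _∨_ _∧_ ⊤ ⊥ₗ
    ∧-distribˡ-∨     : ∀ x y z → (x ∧ (y ∨ z)) ≈ ((x ∧ y) ∨ (x ∧ z))

  open IsBoundedLattice isBoundedLattice public

module _ {c ℓ₁ ℓ₂} (L : BDLattice c ℓ₁ ℓ₂) where
  open BDLattice L

  PLevel : Level
  PLevel = c ⊔ ℓ₁ ⊔ ℓ₂

  record IsFilter (F : Pred Carrier PLevel) : Set (c ⊔ ℓ₁ ⊔ ℓ₂) where
    field
      up   : ∀ {a b} → a ∈ F → a ≤ b → b ∈ F
      top  : ⊤ ∈ F
      meet : ∀ {a b} → a ∈ F → b ∈ F → (a ∧ b) ∈ F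

  record IsIdeal (I : Pred Carrier PLevel) : Set (c ⊔ ℓ₁ ⊔ ℓ₂) where
    field
      down : ∀ {a b} → a ∈ I → b ≤ a → b ∈ I
      bot  : ⊥ₗ ∈ I
      join : ∀ {a b} → a ∈ I → b ∈ I → (a ∨ b) ∈ I

  record IsPrimeFilter (P : Pred Carrier PLevel) : Set (c ⊔ ℓ₁ ⊔ ℓ₂) where
    field
      isFilter : IsFilter P
      proper   : ⊥ₗ ∉ P
      prime    : ∀ {a b} → (a ∨ b) ∈ P → a ∈ P ⊎ b ∈ P
    open IsFilter isFilter public

  record PrimeFilter : Set (suc (c ⊔ ℓ₁ ⊔ ℓ₂)) where
    field
      set     : Pred Carrier PLevel
      isPrime : IsPrimeFilter set

-- The prime filter theorem for bounded distributive lattices (a theorem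
-- of ZFC, used as an ambient classical axiom).
PrimeFilterTheorem : (c ℓ₁ ℓ₂ : Level) → Set (suc (c ⊔ ℓ₁ ⊔ ℓ₂))
PrimeFilterTheorem c ℓ₁ ℓ₂ =
  (L : BDLattice c ℓ₁ ℓ₂) →
  let open BDLattice L in
  (F I : Pred Carrier (PLevel L)) → IsFilter L F → IsIdeal L I →
  (∀ a → a ∈ F → a ∈ I → ⊥) →
  Σ (PrimeFilter L) λ P → F ⊆ PrimeFilter.set P × (∀ a → a ∈ PrimeFilter.set P → a ∈ I → ⊥)

record ModalAlgebra (c ℓ₁ ℓ₂ : Level) : Set (suc (c ⊔ ℓ₁ ⊔ ℓ₂)) where
  field
    lattice : BDLattice c ℓ₁ ℓ₂
  open BDLattice lattice public
  field
    □₊ ◇₊ □₋ ◇₋ : Op₁ Carrier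
    □₊-cong : ∀ {a b} → a ≈ b → □₊ a ≈ □₊ b
    ◇₊-cong : ∀ {a b} → a ≈ b → ◇₊ a ≈ ◇₊ b
    □₋-cong : ∀ {a b} → a ≈ b → □₋ a ≈ □₋ b
    ◇₋-cong : ∀ {a b} → a ≈ b → ◇₋ a ≈ ◇₋ b
    □₊-∧ : ∀ a b → □₊ (a ∧ b) ≈ (□₊ a ∧ □₊ b)
    □₊-⊤ : □₊ ⊤ ≈ ⊤
    ◇₊-∨ : ∀ a b → ◇₊ (a ∨ b) ≈ (◇₊ a ∨ ◇₊ b)
    ◇₊-⊥ : ◇₊ ⊥ₗ ≈ ⊥ₗ
    □₋-∨ : ∀ a b → □₋ (a ∨ b) ≈ (□₋ a ∧ □₋ b)
    □₋-⊥ : □₋ ⊥ₗ ≈ ⊤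
    ◇₋-∧ : ∀ a b → ◇₋ (a ∧ b) ≈ (◇₋ a ∨ ◇₋ b)
    ◇₋-⊤ : ◇₋ ⊤ ≈ ⊥ₗ

CoExponential : ∀ {c ℓ₂} {A : Set c} → Rel A ℓ₂ → Op₂ A → Op₂ A → Set (c ⊔ ℓ₂)
CoExponential _≤_ _∨_ _−_ =
  ∀ w x y → ((x − y) ≤ w → x ≤ (y ∨ w)) × (x ≤ (y ∨ w) → (x − y) ≤ w)

module _ {a : Level} {W : Set a} where
  infix 4 _⊆ᵣ_
  infixr 6 _∩ᵣ_
  infixr 5 _⨾_

  _⊆ᵣ_ : ∀ {ℓ ℓ'} → Rel W ℓ → Rel W ℓ' → Set (a ⊔ ℓ ⊔ ℓ')
  R ⊆ᵣ S = ∀ {x y} → R x y → S x y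

  _∩ᵣ_ : ∀ {ℓ} → Rel W ℓ → Rel W ℓ → Rel W ℓ
  (R ∩ᵣ S) x y = R x y × S x y

  _⨾_ : ∀ {ℓ} → Rel W ℓ → Rel W ℓ → Rel W (a ⊔ ℓ)
  (R ⨾ S) x z = ∃ λ y → R x y × S y z

module Canonical {c ℓ₁ ℓ₂} (M : ModalAlgebra c ℓ₁ ℓ₂) where
  open ModalAlgebra M

  World : Set (suc (c ⊔ ℓ₁ ⊔ ℓ₂))
  World = PrimeFilter lattice

  ∣_∣ : World → Pred Carrier (PLevel lattice)
  ∣ U ∣ = PrimeFilter.set U

  _⊑_ _⊒_ : Rel World (c ⊔ ℓ₁ ⊔ ℓ₂)
  U ⊑ V = ∀ a → a ∈ ∣ U ∣ → a ∈ ∣ V ∣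
  U ⊒ V = V ⊑ U

  R□₊ R□₋ R◇₊ R◇₋ : Rel World (c ⊔ ℓ₁ ⊔ ℓ₂)
  R□₊ U V = ∀ a → □₊ a ∈ ∣ U ∣ → a ∈ ∣ V ∣
  R□₋ U V = ∀ a → □₋ a ∈ ∣ U ∣ → a ∉ ∣ V ∣
  R◇₊ U V = ∀ a → a ∈ ∣ V ∣ → ◇₊ a ∈ ∣ U ∣
  R◇₋ U V = ∀ a → a ∉ ∣ V ∣ → ◇₋ a ∈ ∣ U ∣

module Conditions {c ℓ₁ ℓ₂} (M : ModalAlgebra c ℓ₁ ℓ₂) where
  open ModalAlgebra M
  open Canonical M

  Eq₁ Eq₂ Eq₃ Eq₄ Eq₅ Eq₆ Eq₇ Eq₈ : Set (c ⊔ ℓ₂)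
  Eq₁ = ∀ a b → (□₊ a ∧ ◇₊ b) ≤ ◇₊ (a ∧ b)
  Eq₂ = ∀ a b → (□₋ a ∧ ◇₋ b) ≤ ◇₋ (a ∨ b)
  Eq₃ = ∀ a b → □₊ (a ∨ b) ≤ (□₊ a ∨ ◇₊ b)
  Eq₄ = ∀ a b → □₋ (a ∧ b) ≤ (□₋ a ∨ ◇₋ b)
  Eq₅ = ∀ a → (□₋ a ∧ ◇₊ a) ≤ ⊥ₗ
  Eq₆ = ∀ a → (□₊ a ∧ ◇₋ a) ≤ ⊥ₗ
  Eq₇ = ∀ a → ⊤ ≤ (□₊ a ∨ ◇₋ a)
  Eq₈ = ∀ a → ⊤ ≤ (□₋ a ∨ ◇₊ a)

  Eq₉ : Op₂ Carrier → Set (c ⊔ ℓ₂)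
  Eq₉ _⇒_ = ∀ a b → (◇₊ a ⇒ □₊ b) ≤ □₊ (a ⇒ b)
  Eq₁₀ : Op₂ Carrier → Op₂ Carrier → Set (c ⊔ ℓ₂)
  Eq₁₀ _⇒_ _−_ = ∀ a b → ◇₋ (a ⇒ b) ≤ (◇₋ b − □₋ a)
  Eq₁₁ : Op₂ Carrier → Set (c ⊔ ℓ₂)
  Eq₁₁ _−_ = ∀ a b → ◇₊ (b − a) ≤ (◇₊ b − □₊ a)
  Eq₁₂ : Op₂ Carrier → Op₂ Carrier → Set (c ⊔ ℓ₂)
  Eq₁₂ _⇒_ _−_ = ∀ a b → (◇₋ a ⇒ □₋ b) ≤ □₋ (b − a)
  Eq₁₃ : Op₂ Carrier → Set (c ⊔ ℓ₂)
  Eq₁₃ _⇒_ = ∀ a → □₋ a ≤ □₊ (a ⇒ ⊥ₗ)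
  Eq₁₄ : Op₂ Carrier → Set (c ⊔ ℓ₂)
  Eq₁₄ _⇒_ = ∀ a → ◇₋ (a ⇒ ⊥ₗ) ≤ ◇₊ a
  Eq₁₅ : Op₂ Carrier → Set (c ⊔ ℓ₂)
  Eq₁₅ _−_ = ∀ a → ◇₊ (⊤ − a) ≤ ◇₋ a
  Eq₁₆ : Op₂ Carrier → Set (c ⊔ ℓ₂)
  Eq₁₆ _−_ = ∀ a → □₊ a ≤ □₋ (⊤ − a)

  Fr₁ Fr₂ Fr₃ Fr₄ Fr₅ Fr₆ Fr₇ Fr₈ Fr₉ Fr₁₀ Fr₁₁ Fr₁₂ Fr₁₃ Fr₁₄ Fr₁₅ Fr₁₆
    : Set (suc (c ⊔ ℓ₁ ⊔ ℓ₂))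
  Fr₁  = R◇₊ ⊆ᵣ (R◇₊ ∩ᵣ R□₊) ⨾ _⊒_
  Fr₂  = R◇₋ ⊆ᵣ (R◇₋ ∩ᵣ R□₋) ⨾ _⊑_
  Fr₃  = R□₊ ⊆ᵣ (R□₊ ∩ᵣ R◇₊) ⨾ _⊑_
  Fr₄  = R□₋ ⊆ᵣ (R□₋ ∩ᵣ R◇₋) ⨾ _⊒_
  Fr₅  = R◇₊ ⊆ᵣ R□₋
  Fr₆  = R◇₋ ⊆ᵣ R□₊
  Fr₇  = R□₊ ⊆ᵣ R◇₋
  Fr₈  = R□₋ ⊆ᵣ R◇₊
  Fr₉  = R□₊ ⊆ᵣ _⊑_ ⨾ (R□₊ ∩ᵣ R◇₊)
  Fr₁₀ = R◇₋ ⊆ᵣ _⊒_ ⨾ (R◇₋ ∩ᵣ R□₋)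
  Fr₁₁ = R◇₊ ⊆ᵣ _⊒_ ⨾ (R◇₊ ∩ᵣ R□₊)
  Fr₁₂ = R□₋ ⊆ᵣ _⊑_ ⨾ (R□₋ ∩ᵣ R◇₋)
  Fr₁₃ = R□₊ ⊆ᵣ R□₋
  Fr₁₄ = R◇₋ ⊆ᵣ R◇₊
  Fr₁₅ = R◇₊ ⊆ᵣ R◇₋
  Fr₁₆ = R□₋ ⊆ᵣ R□₊

-- Every frame condition asks for prime filters W related in prescribed ways to given
-- prime filters U and V. Each requirement on W says either that W contains a certain
-- filter or that W misses a certain ideal; these filters and ideals are built from U and V
-- through the modal operators. The equation is exactly what makes the join of the
-- required filters disjoint from the join of the required ideals, and the prime filter
-- theorem then produces W. The conditions without an existential need only primality.
module Submission where

open import Defs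
open import Level using (_⊔_)
open import Data.Product using (_×_; _,_; ∃; Σ; proj₁; proj₂)
open import Data.Sum using ([_,_])
open import Data.Empty using (⊥-elim)
open import Relation.Unary using (Pred; _∈_; _∉_; ∁)
open import Relation.Binary.Lattice.Bundles using (Lattice)
open import Relation.Binary.Lattice.Definitions using (Exponential)
open import Axiom.ExcludedMiddle using (ExcludedMiddle)
open import Axiom.DoubleNegationElimination using (DoubleNegationElimination; em⇒dne)
open import Algebra.Core using (Op₁; Op₂)
import Relation.Binary.Lattice.Properties.JoinSemilattice as JoinSemilatticeProperties
import Relation.Binary.Lattice.Properties.MeetSemilattice as MeetSemilatticeProperties
import Relation.Binary.Reasoning.PartialOrder as ≤-Reasoning

module LatticeFacts {c ℓ₁ ℓ₂} (L : BDLattice c ℓ₁ ℓ₂) where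
  open BDLattice L

  private
    bundle : Lattice c ℓ₁ ℓ₂
    bundle = record { isLattice = isLattice }

  open Lattice bundle public using (poset)
  open JoinSemilatticeProperties (Lattice.joinSemilattice bundle) public
    using (∨-monotonic; x≤y⇒x∨y≈y)
  open MeetSemilatticeProperties (Lattice.meetSemilattice bundle) public
    using (∧-monotonic; y≤x⇒x∧y≈y)

  Subset : Set _
  Subset = Pred Carrier (PLevel L)

  ↑[_]_ ↓[_]_ : Op₁ Carrier → Subset → Subset
  (↑[ f ] S) x = ∃ λ a → a ∈ S × f a ≤ x
  (↓[ f ] S) x = ∃ λ a → a ∈ S × x ≤ f a

  ↑-image-isFilter : ∀ {f S s} (_⊙_ : Op₂ Carrier) → s ∈ S →
                     (∀ {a b} → a ∈ S → b ∈ S → (a ⊙ b) ∈ S) →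
                     (∀ a b → f (a ⊙ b) ≤ f a ∧ f b) → IsFilter L (↑[ f ] S)
  ↑-image-isFilter _⊙_ s∈S ⊙-closed f-⊙ = record
    { up   = λ { (a , a∈S , fa≤x) x≤y → a , a∈S , trans fa≤x x≤y }
    ; top  = _ , s∈S , maximum _
    ; meet = λ { (a , a∈S , fa≤x) (b , b∈S , fb≤y) →
               a ⊙ b , ⊙-closed a∈S b∈S , trans (f-⊙ a b) (∧-monotonic fa≤x fb≤y) }
    }

  ↓-image-isIdeal : ∀ {f S s} (_⊙_ : Op₂ Carrier) → s ∈ S →
                    (∀ {a b} → a ∈ S → b ∈ S → (a ⊙ b) ∈ S) →
                    (∀ a b → f a ∨ f b ≤ f (a ⊙ b)) → IsIdeal L (↓[ f ] S)
  ↓-image-isIdeal _⊙_ s∈S ⊙-closed f-⊙ = record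
    { down = λ { (a , a∈S , x≤fa) y≤x → a , a∈S , trans y≤x x≤fa }
    ; bot  = _ , s∈S , minimum _
    ; join = λ { (a , a∈S , x≤fa) (b , b∈S , y≤fb) →
               a ⊙ b , ⊙-closed a∈S b∈S , trans (∨-monotonic x≤fa y≤fb) (f-⊙ a b) }
    }

  _⊔ᶠ_ _⊔ⁱ_ : Subset → Subset → Subset
  (F ⊔ᶠ G) x = ∃ λ a → ∃ λ b → a ∈ F × b ∈ G × a ∧ b ≤ x
  (I ⊔ⁱ J) x = ∃ λ a → ∃ λ b → a ∈ I × b ∈ J × x ≤ a ∨ b

  ⊔ᶠ-isFilter : ∀ {F G} → IsFilter L F → IsFilter L G → IsFilter L (F ⊔ᶠ G)
  ⊔ᶠ-isFilter isF isG = record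
    { up   = λ { (a , b , a∈F , b∈G , a∧b≤x) x≤y → a , b , a∈F , b∈G , trans a∧b≤x x≤y }
    ; top  = ⊤ , ⊤ , F.top , G.top , maximum _
    ; meet = λ { (a , b , a∈F , b∈G , a∧b≤x) (a′ , b′ , a′∈F , b′∈G , a′∧b′≤y) →
               a ∧ a′ , b ∧ b′ , F.meet a∈F a′∈F , G.meet b∈G b′∈G ,
               ∧-greatest (trans (∧-monotonic (x∧y≤x _ _) (x∧y≤x _ _)) a∧b≤x)
                          (trans (∧-monotonic (x∧y≤y _ _) (x∧y≤y _ _)) a′∧b′≤y) }
    }
    where module F = IsFilter isF
          module G = IsFilter isG

  ⊔ⁱ-isIdeal : ∀ {I J} → IsIdeal L I → IsIdeal L J → IsIdeal L (I ⊔ⁱ J)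
  ⊔ⁱ-isIdeal isI isJ = record
    { down = λ { (a , b , a∈I , b∈J , x≤a∨b) y≤x → a , b , a∈I , b∈J , trans y≤x x≤a∨b }
    ; bot  = ⊥ₗ , ⊥ₗ , I.bot , J.bot , minimum _
    ; join = λ { (a , b , a∈I , b∈J , x≤a∨b) (a′ , b′ , a′∈I , b′∈J , y≤a′∨b′) →
               a ∨ a′ , b ∨ b′ , I.join a∈I a′∈I , J.join b∈J b′∈J ,
               ∨-least (trans x≤a∨b (∨-monotonic (x≤x∨y _ _) (x≤x∨y _ _)))
                       (trans y≤a′∨b′ (∨-monotonic (y≤x∨y _ _) (y≤x∨y _ _))) }
    }
    where module I = IsIdeal isI
          module J = IsIdeal isJ

  module _ (P : PrimeFilter L) where
    open PrimeFilter P
    open IsPrimeFilter isPrime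

    ∁-isIdeal : IsIdeal L (∁ set)
    ∁-isIdeal = record
      { down = λ a∉P b≤a b∈P → a∉P (up b∈P b≤a)
      ; bot  = proper
      ; join = λ a∉P b∉P a∨b∈P → [ a∉P , b∉P ] (prime a∨b∈P)
      }

    ⇒-modusPonens : ∀ {_⇒_} → Exponential _≤_ _∧_ _⇒_ →
                    ∀ {a b} → a ∈ set → (a ⇒ b) ∈ set → b ∈ set
    ⇒-modusPonens {_⇒_} exp {a} {b} a∈P a⇒b∈P =
      up (meet a⇒b∈P a∈P) (proj₂ (exp (a ⇒ b) a b) refl)

    ⇒⊥-∉ : ∀ {_⇒_} → Exponential _≤_ _∧_ _⇒_ → ∀ {a} → a ∈ set → (a ⇒ ⊥ₗ) ∉ set
    ⇒⊥-∉ exp a∈P a⇒⊥∈P = proper (⇒-modusPonens exp a∈P a⇒⊥∈P)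

    −-∈ : ∀ {_−_} → CoExponential _≤_ _∨_ _−_ → ∀ {a b} → b ∈ set → a ∉ set → (b − a) ∈ set
    −-∈ {_−_} cexp {a} {b} b∈P a∉P =
      [ (λ a∈P → ⊥-elim (a∉P a∈P)) , (λ b−a∈P → b−a∈P) ]
        (prime (up b∈P (proj₁ (cexp (b − a) b a) refl)))

module Separation {c ℓ₁ ℓ₂} (pft : PrimeFilterTheorem c ℓ₁ ℓ₂) (L : BDLattice c ℓ₁ ℓ₂) where
  open BDLattice L
  open LatticeFacts L

  infix 4 _⊆ᵂ_ _#_

  _⊆ᵂ_ _#_ : Subset → PrimeFilter L → Set _
  F ⊆ᵂ W = ∀ a → a ∈ F → a ∈ PrimeFilter.set W
  I # W  = ∀ a → a ∈ I → a ∉ PrimeFilter.set W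

  separate : ∀ {F I} → IsFilter L F → IsIdeal L I → (∀ a → a ∈ F → a ∉ I) →
             Σ (PrimeFilter L) λ W → F ⊆ᵂ W × I # W
  separate {F} {I} isF isI F∩I=∅ =
    let W , F⊆W , W∩I=∅ = pft L F I isF isI F∩I=∅
    in  W , (λ a a∈F → F⊆W a∈F) , (λ a a∈I a∈W → W∩I=∅ a a∈W a∈I)

  separate-⊔ᶠ : ∀ {F G I} → IsFilter L F → IsFilter L G → IsIdeal L I →
                (∀ a b → a ∈ F → b ∈ G → a ∧ b ∉ I) →
                Σ (PrimeFilter L) λ W → F ⊆ᵂ W × G ⊆ᵂ W × I # W
  separate-⊔ᶠ isF isG isI disjoint =
    let W , F⊔G⊆W , I#W = separate (⊔ᶠ-isFilter isF isG) isI
          λ { x (a , b , a∈F , b∈G , a∧b≤x) x∈I →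
                disjoint a b a∈F b∈G (IsIdeal.down isI x∈I a∧b≤x) }
    in  W , (λ a a∈F → F⊔G⊆W a (a , ⊤ , a∈F , IsFilter.top isG , x∧y≤x _ _))
          , (λ b b∈G → F⊔G⊆W b (⊤ , b , IsFilter.top isF , b∈G , x∧y≤y _ _))
          , I#W

  separate-⊔ⁱ : ∀ {F I J} → IsFilter L F → IsIdeal L I → IsIdeal L J →
                (∀ a b → a ∈ I → b ∈ J → a ∨ b ∉ F) →
                Σ (PrimeFilter L) λ W → F ⊆ᵂ W × I # W × J # W
  separate-⊔ⁱ isF isI isJ disjoint =
    let W , F⊆W , I⊔J#W = separate isF (⊔ⁱ-isIdeal isI isJ)
          λ { x x∈F (a , b , a∈I , b∈J , x≤a∨b) →
                disjoint a b a∈I b∈J (IsFilter.up isF x∈F x≤a∨b) }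
    in  W , F⊆W
          , (λ a a∈I → I⊔J#W a (a , ⊥ₗ , a∈I , IsIdeal.bot isJ , x≤x∨y _ _))
          , (λ b b∈J → I⊔J#W b (⊥ₗ , b , IsIdeal.bot isI , b∈J , y≤x∨y _ _))

module ModalFacts {c ℓ₁ ℓ₂} (M : ModalAlgebra c ℓ₁ ℓ₂) where
  open ModalAlgebra M
  open Canonical M
  open LatticeFacts lattice
  open ≤-Reasoning poset

  □₊-mono : ∀ {a b} → a ≤ b → □₊ a ≤ □₊ b
  □₊-mono {a} {b} a≤b = begin
    □₊ a        ≈⟨ □₊-cong (y≤x⇒x∧y≈y a≤b) ⟨
    □₊ (b ∧ a)  ≈⟨ □₊-∧ b a ⟩
    □₊ b ∧ □₊ a ≤⟨ x∧y≤x _ _ ⟩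
    □₊ b        ∎

  ◇₊-mono : ∀ {a b} → a ≤ b → ◇₊ a ≤ ◇₊ b
  ◇₊-mono {a} {b} a≤b = begin
    ◇₊ a        ≤⟨ x≤x∨y _ _ ⟩
    ◇₊ a ∨ ◇₊ b ≈⟨ ◇₊-∨ a b ⟨
    ◇₊ (a ∨ b)  ≈⟨ ◇₊-cong (x≤y⇒x∨y≈y a≤b) ⟩
    ◇₊ b        ∎

  □₋-anti : ∀ {a b} → a ≤ b → □₋ b ≤ □₋ a
  □₋-anti {a} {b} a≤b = begin
    □₋ b        ≈⟨ □₋-cong (x≤y⇒x∨y≈y a≤b) ⟨
    □₋ (a ∨ b)  ≈⟨ □₋-∨ a b ⟩
    □₋ a ∧ □₋ b ≤⟨ x∧y≤x _ _ ⟩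
    □₋ a        ∎

  ◇₋-anti : ∀ {a b} → a ≤ b → ◇₋ b ≤ ◇₋ a
  ◇₋-anti {a} {b} a≤b = begin
    ◇₋ b        ≤⟨ x≤x∨y _ _ ⟩
    ◇₋ b ∨ ◇₋ a ≈⟨ ◇₋-∧ b a ⟨
    ◇₋ (b ∧ a)  ≈⟨ ◇₋-cong (y≤x⇒x∧y≈y a≤b) ⟩
    ◇₋ a        ∎

  □₊⁻¹ □₋⁻¹ ◇₊⁻¹∁ ◇₋⁻¹∁ : World → Subset
  □₊⁻¹ U a  = □₊ a ∈ ∣ U ∣
  □₋⁻¹ U a  = □₋ a ∈ ∣ U ∣
  ◇₊⁻¹∁ U a = ◇₊ a ∉ ∣ U ∣
  ◇₋⁻¹∁ U a = ◇₋ a ∉ ∣ U ∣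

  module _ (U : World) where
    open IsPrimeFilter (PrimeFilter.isPrime U)

    □₊⁻¹-isFilter : IsFilter lattice (□₊⁻¹ U)
    □₊⁻¹-isFilter = record
      { up   = λ □a∈U a≤b → up □a∈U (□₊-mono a≤b)
      ; top  = up top (reflexive (Eq.sym □₊-⊤))
      ; meet = λ □a∈U □b∈U → up (meet □a∈U □b∈U) (reflexive (Eq.sym (□₊-∧ _ _)))
      }

    □₋⁻¹-isIdeal : IsIdeal lattice (□₋⁻¹ U)
    □₋⁻¹-isIdeal = record
      { down = λ □a∈U b≤a → up □a∈U (□₋-anti b≤a)
      ; bot  = up top (reflexive (Eq.sym □₋-⊥))
      ; join = λ □a∈U □b∈U → up (meet □a∈U □b∈U) (reflexive (Eq.sym (□₋-∨ _ _)))
      }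

    ◇₊⁻¹∁-isIdeal : IsIdeal lattice (◇₊⁻¹∁ U)
    ◇₊⁻¹∁-isIdeal = record
      { down = λ ◇a∉U b≤a ◇b∈U → ◇a∉U (up ◇b∈U (◇₊-mono b≤a))
      ; bot  = λ ◇⊥∈U → proper (up ◇⊥∈U (reflexive ◇₊-⊥))
      ; join = λ ◇a∉U ◇b∉U ◇a∨b∈U →
                 [ ◇a∉U , ◇b∉U ] (prime (up ◇a∨b∈U (reflexive (◇₊-∨ _ _))))
      }

    ◇₋⁻¹∁-isFilter : IsFilter lattice (◇₋⁻¹∁ U)
    ◇₋⁻¹∁-isFilter = record
      { up   = λ ◇a∉U a≤b ◇b∈U → ◇a∉U (up ◇b∈U (◇₋-anti a≤b))
      ; top  = λ ◇⊤∈U → proper (up ◇⊤∈U (reflexive ◇₋-⊤))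
      ; meet = λ ◇a∉U ◇b∉U ◇a∧b∈U →
                 [ ◇a∉U , ◇b∉U ] (prime (up ◇a∧b∈U (reflexive (◇₋-∧ _ _))))
      }

  module _ (V : World) where
    open IsPrimeFilter (PrimeFilter.isPrime V)

    ↑◇₊-isFilter : IsFilter lattice (↑[ ◇₊ ] ∣ V ∣)
    ↑◇₊-isFilter = ↑-image-isFilter _∧_ top meet
      λ _ _ → ∧-greatest (◇₊-mono (x∧y≤x _ _)) (◇₊-mono (x∧y≤y _ _))

    ↑◇₋∁-isFilter : IsFilter lattice (↑[ ◇₋ ] ∁ ∣ V ∣)
    ↑◇₋∁-isFilter = ↑-image-isFilter _∨_ proper (IsIdeal.join (∁-isIdeal V))
      λ _ _ → ∧-greatest (◇₋-anti (x≤x∨y _ _)) (◇₋-anti (y≤x∨y _ _))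

    ↓□₊∁-isIdeal : IsIdeal lattice (↓[ □₊ ] ∁ ∣ V ∣)
    ↓□₊∁-isIdeal = ↓-image-isIdeal _∨_ proper (IsIdeal.join (∁-isIdeal V))
      λ _ _ → ∨-least (□₊-mono (x≤x∨y _ _)) (□₊-mono (y≤x∨y _ _))

    ↓□₋-isIdeal : IsIdeal lattice (↓[ □₋ ] ∣ V ∣)
    ↓□₋-isIdeal = ↓-image-isIdeal _∧_ top meet
      λ _ _ → ∨-least (□₋-anti (x∧y≤x _ _)) (□₋-anti (x∧y≤y _ _))

module Correspondence {c ℓ₁ ℓ₂} (em : ExcludedMiddle (c ⊔ ℓ₁ ⊔ ℓ₂))
  (pft : PrimeFilterTheorem c ℓ₁ ℓ₂) (M : ModalAlgebra c ℓ₁ ℓ₂) where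
  open ModalAlgebra M
  open Canonical M
  open Conditions M
  open LatticeFacts lattice
  open Separation pft lattice
  open ModalFacts M

  private
    module PF (U : World) = IsPrimeFilter (PrimeFilter.isPrime U)
    open PF

    dne : DoubleNegationElimination (c ⊔ ℓ₁ ⊔ ℓ₂)
    dne = em⇒dne em

  ◇₊⁻¹∁#⇒R◇₊ : ∀ U W → ◇₊⁻¹∁ U # W → R◇₊ U W
  ◇₊⁻¹∁#⇒R◇₊ _ _ h a a∈W = dne λ ◇a∉U → h a ◇a∉U a∈W

  ◇₋⁻¹∁⊆⇒R◇₋ : ∀ U W → ◇₋⁻¹∁ U ⊆ᵂ W → R◇₋ U W
  ◇₋⁻¹∁⊆⇒R◇₋ _ _ h a a∉W = dne λ ◇a∉U → a∉W (h a ◇a∉U)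

  ∁#⇒⊑ : ∀ V W → ∁ ∣ V ∣ # W → W ⊑ V
  ∁#⇒⊑ _ _ h a a∈W = dne λ a∉V → h a a∉V a∈W

  ↓□₊∁#⇒R□₊ : ∀ V W → ↓[ □₊ ] ∁ ∣ V ∣ # W → R□₊ W V
  ↓□₊∁#⇒R□₊ _ _ h a □a∈W = dne λ a∉V → h (□₊ a) (a , a∉V , refl) □a∈W

  ↓□₋#⇒R□₋ : ∀ V W → ↓[ □₋ ] ∣ V ∣ # W → R□₋ W V
  ↓□₋#⇒R□₋ _ _ h a □a∈W a∈V = h (□₋ a) (a , a∈V , refl) □a∈W

  ↑◇₊⊆⇒R◇₊ : ∀ V W → ↑[ ◇₊ ] ∣ V ∣ ⊆ᵂ W → R◇₊ W V
  ↑◇₊⊆⇒R◇₊ _ _ h a a∈V = h (◇₊ a) (a , a∈V , refl)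

  ↑◇₋∁⊆⇒R◇₋ : ∀ V W → ↑[ ◇₋ ] ∁ ∣ V ∣ ⊆ᵂ W → R◇₋ W V
  ↑◇₋∁⊆⇒R◇₋ _ _ h a a∉V = h (◇₋ a) (a , a∉V , refl)

  canonical₁ : Eq₁ → Fr₁
  canonical₁ eq {U} {V} uRv =
    let W , □U⊆W , V⊆W , ◇U#W = separate-⊔ᶠ (□₊⁻¹-isFilter U) (isFilter V) (◇₊⁻¹∁-isIdeal U)
          λ a b □a∈U b∈V ◇a∧b∉U → ◇a∧b∉U (up U (meet U □a∈U (uRv b b∈V)) (eq a b))
    in  W , (◇₊⁻¹∁#⇒R◇₊ U W ◇U#W , □U⊆W) , V⊆W

  canonical₂ : Eq₂ → Fr₂
  canonical₂ eq {U} {V} uRv =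
    let W , ◇U⊆W , □U#W , ∁V#W = separate-⊔ⁱ (◇₋⁻¹∁-isFilter U) (□₋⁻¹-isIdeal U) (∁-isIdeal V)
          λ a b □a∈U b∉V ◇a∨b∉U → ◇a∨b∉U (up U (meet U □a∈U (uRv b b∉V)) (eq a b))
    in  W , (◇₋⁻¹∁⊆⇒R◇₋ U W ◇U⊆W , □U#W) , ∁#⇒⊑ V W ∁V#W

  canonical₃ : Eq₃ → Fr₃
  canonical₃ eq {U} {V} uRv =
    let W , □U⊆W , ∁V#W , ◇U#W = separate-⊔ⁱ (□₊⁻¹-isFilter U) (∁-isIdeal V) (◇₊⁻¹∁-isIdeal U)
          λ a b a∉V ◇b∉U □a∨b∈U →
            [ (λ □a∈U → a∉V (uRv a □a∈U)) , ◇b∉U ] (prime U (up U □a∨b∈U (eq a b)))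
    in  W , (□U⊆W , ◇₊⁻¹∁#⇒R◇₊ U W ◇U#W) , ∁#⇒⊑ V W ∁V#W

  canonical₄ : Eq₄ → Fr₄
  canonical₄ eq {U} {V} uRv =
    let W , V⊆W , ◇U⊆W , □U#W = separate-⊔ᶠ (isFilter V) (◇₋⁻¹∁-isFilter U) (□₋⁻¹-isIdeal U)
          λ a b a∈V ◇b∉U □a∧b∈U →
            [ (λ □a∈U → uRv a □a∈U a∈V) , ◇b∉U ] (prime U (up U □a∧b∈U (eq a b)))
    in  W , (□U#W , ◇₋⁻¹∁⊆⇒R◇₋ U W ◇U⊆W) , V⊆W

  canonical₅ : Eq₅ → Fr₅
  canonical₅ eq {U} uRv a □a∈U a∈V = proper U (up U (meet U □a∈U (uRv a a∈V)) (eq a))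

  canonical₆ : Eq₆ → Fr₆
  canonical₆ eq {U} uRv a □a∈U = dne λ a∉V → proper U (up U (meet U □a∈U (uRv a a∉V)) (eq a))

  canonical₇ : Eq₇ → Fr₇
  canonical₇ eq {U} uRv a a∉V =
    [ (λ □a∈U → ⊥-elim (a∉V (uRv a □a∈U))) , (λ ◇a∈U → ◇a∈U) ] (prime U (up U (top U) (eq a)))

  canonical₈ : Eq₈ → Fr₈
  canonical₈ eq {U} uRv a a∈V =
    [ (λ □a∈U → ⊥-elim (uRv a □a∈U a∈V)) , (λ ◇a∈U → ◇a∈U) ] (prime U (up U (top U) (eq a)))

  canonical₉ : ∀ (_⇒_ : Op₂ Carrier) → Exponential _≤_ _∧_ _⇒_ → Eq₉ _⇒_ → Fr₉
  canonical₉ _⇒_ exp eq {U} {V} uRv =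
    let W , U⊆W , ◇V⊆W , □∁V#W = separate-⊔ᶠ (isFilter U) (↑◇₊-isFilter V) (↓□₊∁-isIdeal V) disjoint
    in  W , U⊆W , ↓□₊∁#⇒R□₊ V W □∁V#W , ↑◇₊⊆⇒R◇₊ V W ◇V⊆W
    where
    disjoint : ∀ u x → u ∈ ∣ U ∣ → x ∈ ↑[ ◇₊ ] ∣ V ∣ → u ∧ x ∉ ↓[ □₊ ] ∁ ∣ V ∣
    disjoint u x u∈U (a , a∈V , ◇a≤x) (b , b∉V , u∧x≤□b) =
      b∉V (⇒-modusPonens V exp a∈V (uRv (a ⇒ b) □a⇒b∈U))
      where
      u∧◇a≤□b : u ∧ ◇₊ a ≤ □₊ b
      u∧◇a≤□b = trans (∧-monotonic refl ◇a≤x) u∧x≤□b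
      □a⇒b∈U : □₊ (a ⇒ b) ∈ ∣ U ∣
      □a⇒b∈U = up U u∈U (trans (proj₁ (exp u (◇₊ a) (□₊ b)) u∧◇a≤□b) (eq a b))

  canonical₁₀ : ∀ (_⇒_ _−_ : Op₂ Carrier) → Exponential _≤_ _∧_ _⇒_ → CoExponential _≤_ _∨_ _−_ →
                Eq₁₀ _⇒_ _−_ → Fr₁₀
  canonical₁₀ _⇒_ _−_ exp cexp eq {U} {V} uRv =
    let W , ◇∁V⊆W , □V#W , ∁U#W = separate-⊔ⁱ (↑◇₋∁-isFilter V) (↓□₋-isIdeal V) (∁-isIdeal U) disjoint
    in  W , ∁#⇒⊑ U W ∁U#W , ↑◇₋∁⊆⇒R◇₋ V W ◇∁V⊆W , ↓□₋#⇒R□₋ V W □V#W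
    where
    disjoint : ∀ x y → x ∈ ↓[ □₋ ] ∣ V ∣ → y ∉ ∣ U ∣ → x ∨ y ∉ ↑[ ◇₋ ] ∁ ∣ V ∣
    disjoint x y (b , b∈V , x≤□b) y∉U (a , a∉V , ◇a≤x∨y) =
      y∉U (up U (uRv (b ⇒ a) b⇒a∉V) (trans (eq b a) ◇a−□b≤y))
      where
      b⇒a∉V : (b ⇒ a) ∉ ∣ V ∣
      b⇒a∉V b⇒a∈V = a∉V (⇒-modusPonens V exp b∈V b⇒a∈V)
      ◇a−□b≤y : ◇₋ a − □₋ b ≤ y
      ◇a−□b≤y = proj₂ (cexp y (◇₋ a) (□₋ b)) (trans ◇a≤x∨y (∨-monotonic x≤□b refl))

  canonical₁₁ : ∀ (_−_ : Op₂ Carrier) → CoExponential _≤_ _∨_ _−_ → Eq₁₁ _−_ → Fr₁₁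
  canonical₁₁ _−_ cexp eq {U} {V} uRv =
    let W , ◇V⊆W , □∁V#W , ∁U#W = separate-⊔ⁱ (↑◇₊-isFilter V) (↓□₊∁-isIdeal V) (∁-isIdeal U) disjoint
    in  W , ∁#⇒⊑ U W ∁U#W , ↑◇₊⊆⇒R◇₊ V W ◇V⊆W , ↓□₊∁#⇒R□₊ V W □∁V#W
    where
    disjoint : ∀ x y → x ∈ ↓[ □₊ ] ∁ ∣ V ∣ → y ∉ ∣ U ∣ → x ∨ y ∉ ↑[ ◇₊ ] ∣ V ∣
    disjoint x y (b , b∉V , x≤□b) y∉U (a , a∈V , ◇a≤x∨y) =
      y∉U (up U (uRv (a − b) (−-∈ V cexp a∈V b∉V)) (trans (eq b a) ◇a−□b≤y))
      where
      ◇a−□b≤y : ◇₊ a − □₊ b ≤ y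
      ◇a−□b≤y = proj₂ (cexp y (◇₊ a) (□₊ b)) (trans ◇a≤x∨y (∨-monotonic x≤□b refl))

  canonical₁₂ : ∀ (_⇒_ _−_ : Op₂ Carrier) → Exponential _≤_ _∧_ _⇒_ → CoExponential _≤_ _∨_ _−_ →
                Eq₁₂ _⇒_ _−_ → Fr₁₂
  canonical₁₂ _⇒_ _−_ exp cexp eq {U} {V} uRv =
    let W , U⊆W , ◇∁V⊆W , □V#W = separate-⊔ᶠ (isFilter U) (↑◇₋∁-isFilter V) (↓□₋-isIdeal V) disjoint
    in  W , U⊆W , ↓□₋#⇒R□₋ V W □V#W , ↑◇₋∁⊆⇒R◇₋ V W ◇∁V⊆W
    where
    disjoint : ∀ u y → u ∈ ∣ U ∣ → y ∈ ↑[ ◇₋ ] ∁ ∣ V ∣ → u ∧ y ∉ ↓[ □₋ ] ∣ V ∣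
    disjoint u y u∈U (a , a∉V , ◇a≤y) (b , b∈V , u∧y≤□b) =
      uRv (b − a) □b−a∈U (−-∈ V cexp b∈V a∉V)
      where
      u∧◇a≤□b : u ∧ ◇₋ a ≤ □₋ b
      u∧◇a≤□b = trans (∧-monotonic refl ◇a≤y) u∧y≤□b
      □b−a∈U : □₋ (b − a) ∈ ∣ U ∣
      □b−a∈U = up U u∈U (trans (proj₁ (exp u (◇₋ a) (□₋ b)) u∧◇a≤□b) (eq a b))

  canonical₁₃ : ∀ (_⇒_ : Op₂ Carrier) → Exponential _≤_ _∧_ _⇒_ → Eq₁₃ _⇒_ → Fr₁₃
  canonical₁₃ _⇒_ exp eq {U} {V} uRv a □a∈U a∈V = ⇒⊥-∉ V exp a∈V (uRv (a ⇒ ⊥ₗ) (up U □a∈U (eq a)))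

  canonical₁₄ : ∀ (_⇒_ : Op₂ Carrier) → Exponential _≤_ _∧_ _⇒_ → Eq₁₄ _⇒_ → Fr₁₄
  canonical₁₄ _⇒_ exp eq {U} {V} uRv a a∈V = up U (uRv (a ⇒ ⊥ₗ) (⇒⊥-∉ V exp a∈V)) (eq a)

  canonical₁₅ : ∀ (_−_ : Op₂ Carrier) → CoExponential _≤_ _∨_ _−_ → Eq₁₅ _−_ → Fr₁₅
  canonical₁₅ _−_ cexp eq {U} {V} uRv a a∉V = up U (uRv (⊤ − a) (−-∈ V cexp (top V) a∉V)) (eq a)

  canonical₁₆ : ∀ (_−_ : Op₂ Carrier) → CoExponential _≤_ _∨_ _−_ → Eq₁₆ _−_ → Fr₁₆
  canonical₁₆ _−_ cexp eq {U} {V} uRv a □a∈U =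
    dne λ a∉V → uRv (⊤ − a) (up U □a∈U (eq a)) (−-∈ V cexp (top V) a∉V)

mainTheorem11 : ∀ {c ℓ₁ ℓ₂} →
    ExcludedMiddle (c ⊔ ℓ₁ ⊔ ℓ₂) →
    PrimeFilterTheorem c ℓ₁ ℓ₂ →
    (M : ModalAlgebra c ℓ₁ ℓ₂) →
    let open ModalAlgebra M
        open Conditions M
    in (Eq₁ → Fr₁) × (Eq₂ → Fr₂) × (Eq₃ → Fr₃) × (Eq₄ → Fr₄)
     × (Eq₅ → Fr₅) × (Eq₆ → Fr₆) × (Eq₇ → Fr₇) × (Eq₈ → Fr₈)
     × (∀ (_⇒_ : Op₂ Carrier) → Exponential _≤_ _∧_ _⇒_ → Eq₉ _⇒_ → Fr₉)
     × (∀ (_⇒_ _−_ : Op₂ Carrier) → Exponential _≤_ _∧_ _⇒_ → CoExponential _≤_ _∨_ _−_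
          → Eq₁₀ _⇒_ _−_ → Fr₁₀)
     × (∀ (_−_ : Op₂ Carrier) → CoExponential _≤_ _∨_ _−_ → Eq₁₁ _−_ → Fr₁₁)
     × (∀ (_⇒_ _−_ : Op₂ Carrier) → Exponential _≤_ _∧_ _⇒_ → CoExponential _≤_ _∨_ _−_
          → Eq₁₂ _⇒_ _−_ → Fr₁₂)
     × (∀ (_⇒_ : Op₂ Carrier) → Exponential _≤_ _∧_ _⇒_ → Eq₁₃ _⇒_ → Fr₁₃)
     × (∀ (_⇒_ : Op₂ Carrier) → Exponential _≤_ _∧_ _⇒_ → Eq₁₄ _⇒_ → Fr₁₄)
     × (∀ (_−_ : Op₂ Carrier) → CoExponential _≤_ _∨_ _−_ → Eq₁₅ _−_ → Fr₁₅)
     × (∀ (_−_ : Op₂ Carrier) → CoExponential _≤_ _∨_ _−_ → Eq₁₆ _−_ → Fr₁₆)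
mainTheorem11 em pft M =
  canonical₁ , canonical₂ , canonical₃ , canonical₄ ,
  canonical₅ , canonical₆ , canonical₇ , canonical₈ ,
  canonical₉ , canonical₁₀ , canonical₁₁ , canonical₁₂ ,
  canonical₁₃ , canonical₁₄ , canonical₁₅ , canonical₁₆
  where open Correspondence em pft M
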